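{- For $\mu\in(0,1)$ consider the Markov chain $(\sigma_j)_{j\ge0}$ on $\{0,1\}$ with $\sigma_0=0$ and $P(0\to1)=P(1\to0)=(1-\mu)/2$, let $\nu_L=\sum_{j=1}^L\sigma_j$ and $D(L,\mu)=\mathrm{Var}(\nu_L)/\mathrm E[\nu_L]$. Then for $L\ge1$ \[D(L,\mu)=D_\infty(\mu)\cdot\frac{\sum_{m=1}^L(1-\mu^m)^2}{\sum_{m=1}^L(1-\mu^m)},\qquad D_\infty(\mu)=\frac{1+\mu}{2(1-\mu)}.\]
   Context: This is the state chain of a symmetric stateful digit-wise operation ($|\mathrm{GEN}|=|\mathrm{KILL}|$, $\mu=|\mathrm{PROP}|/N$) with uniformly random symbols started at $0$.
   Formalization: The parameter μ ranges over the rationals in $(0,1)$. -}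

module Defs where

open import Data.Bool using (Bool; true; false)
open import Data.List using (List; []; _∷_)
open import Data.Nat using (ℕ; zero; suc)
open import Data.Rational using (ℚ; 0ℚ; 1ℚ; ½; _+_; _*_; _-_; _÷_; ≢-nonZero)
open import Data.Rational.Properties using (_≟_)
open import Relation.Nullary using (yes; no)

-- The state space {0,1} is encoded as Bool (false = 0, true = 1).

pow : ℚ → ℕ → ℚ
pow q zero    = 1ℚ
pow q (suc m) = q * pow q m

trans : ℚ → Bool → Bool → ℚ
trans μ false false = ½ * (1ℚ + μ)
trans μ false true  = ½ * (1ℚ - μ)
trans μ true  false = ½ * (1ℚ - μ)
trans μ true  true  = ½ * (1ℚ + μ)

-- Expectation of f (σ_1, …, σ_L) for the chain started at σ_0 = s,
-- computed exactly as the sum over all 2^L paths weighted by their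
-- probabilities.
expect : ℚ → Bool → ℕ → (List Bool → ℚ) → ℚ
expect μ s zero    f = f []
expect μ s (suc L) f =
  trans μ s false * expect μ false L (λ r → f (false ∷ r)) +
  trans μ s true  * expect μ true  L (λ r → f (true  ∷ r))

nu : List Bool → ℚ
nu []          = 0ℚ
nu (false ∷ r) = nu r
nu (true  ∷ r) = 1ℚ + nu r

meanNu : ℚ → ℕ → ℚ
meanNu μ L = expect μ false L nu

varNu : ℚ → ℕ → ℚ
varNu μ L = expect μ false L (λ r → nu r * nu r) - meanNu μ L * meanNu μ L

-- Total division on ℚ (x / 0 := 0); only used with nonzero denominators.
_/'_ : ℚ → ℚ → ℚ
x /' y with y ≟ 0ℚ
... | yes _  = 0ℚ
... | no y≢0 = _÷_ x y {{≢-nonZero y≢0}}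

D : ℕ → ℚ → ℚ
D L μ = varNu μ L /' meanNu μ L

Dinf : ℚ → ℚ
Dinf μ = (1ℚ + μ) /' ((1ℚ + 1ℚ) * (1ℚ - μ))

sumFrom1 : ℕ → (ℕ → ℚ) → ℚ
sumFrom1 zero    f = 0ℚ
sumFrom1 (suc L) f = sumFrom1 L f + f (suc L)

-- Conditioning on the first step from state 0, and using the 0 ↔ 1 symmetry of the chain under
-- which ν_L started at 1 has the law of L − ν_L started at 0, gives the recursions
--   E ν_{L+1}   = μ E ν_L + (1 − μ)(L + 1)/2,
--   Var ν_{L+1} = Var ν_L + (1 − μ²)/4 · (L + 1 − 2 E ν_L)².
-- The first one makes (1 − μ)(L + 1 − 2 E ν_L) = 1 − μ^{L+1}, hence 2 E ν_L = Σ (1 − μ^m), and the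
-- second then sums to 4 (1 − μ) Var ν_L = (1 + μ) Σ (1 − μ^m)²; their quotient is the claimed D(L, μ).

module Submission where

open import Defs
open import Data.Bool using (Bool; true; false; not)
open import Data.List using (List; []; _∷_; map; length)
open import Data.Nat using (ℕ; zero; suc; _≥_)
open import Data.Rational
  using (ℚ; 0ℚ; 1ℚ; ½; _+_; _*_; _-_; -_; 1/_; _<_; _≤_; NonZero; ≢-nonZero; nonNegative)
open import Data.Rational.Properties
  using ( _≟_; +-*-commutativeRing; *-1-commutativeMonoid
        ; +-assoc; +-comm; +-identityʳ; +-inverseʳ; *-assoc; *-comm; *-identityˡ; *-identityʳ
        ; *-inverseˡ; *-inverseʳ; *-zeroˡ; *-zeroʳ; *-distribˡ-+; *-distribʳ-+
        ; +-monoˡ-<; +-mono-≤; +-mono-≤-<; *-monoˡ-≤-nonNeg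
        ; <⇒≢; <⇒≤; ≤-refl; ≤-reflexive; ≤-trans; ≤-<-trans )
open import Algebra.Bundles using (CommutativeMonoid)
open import Algebra.Properties.CommutativeSemigroup (CommutativeMonoid.commutativeSemigroup *-1-commutativeMonoid)
  using (interchange)
open import Function using (_∘_)
open import Level using (0ℓ)
open import Relation.Binary.PropositionalEquality
  using (_≡_; _≢_; refl; sym; cong; cong₂; subst; module ≡-Reasoning)
  renaming (trans to ≡-trans)
open import Relation.Nullary using (yes; no; contradiction)
open import Relation.Nullary.Decidable using (dec⇒maybe)
open import Tactic.RingSolver using (solve-∀)
open import Tactic.RingSolver.Core.AlmostCommutativeRing
  using (AlmostCommutativeRing; fromCommutativeRing)

open ≡-Reasoning

ring : AlmostCommutativeRing 0ℓ 0ℓ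
ring = fromCommutativeRing +-*-commutativeRing (λ x → dec⇒maybe (0ℚ ≟ x))

two : ℚ
two = 1ℚ + 1ℚ

fromℕ : ℕ → ℚ
fromℕ zero    = 0ℚ
fromℕ (suc n) = 1ℚ + fromℕ n

/'-unique : ∀ {x y z} → y ≢ 0ℚ → z * y ≡ x → x /' y ≡ z
/'-unique {x} {y} {z} y≢0 zy≡x with y ≟ 0ℚ
... | yes y≡0 = contradiction y≡0 y≢0
... | no y≢0′  = begin
  x * 1/ y        ≡⟨ cong (_* 1/ y) (sym zy≡x) ⟩
  z * y * 1/ y    ≡⟨ *-assoc z y (1/ y) ⟩
  z * (y * 1/ y)  ≡⟨ cong (z *_) (*-inverseʳ y) ⟩
  z * 1ℚ          ≡⟨ *-identityʳ z ⟩
  z               ∎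
  where instance
          y-nonZero : NonZero y
          y-nonZero = ≢-nonZero y≢0′

x/'y*y≡x : ∀ {x y} → y ≢ 0ℚ → x /' y * y ≡ x
x/'y*y≡x {x} {y} y≢0 with y ≟ 0ℚ
... | yes y≡0 = contradiction y≡0 y≢0
... | no y≢0′  = begin
  x * 1/ y * y    ≡⟨ *-assoc x (1/ y) y ⟩
  x * (1/ y * y)  ≡⟨ cong (x *_) (*-inverseˡ y) ⟩
  x * 1ℚ          ≡⟨ *-identityʳ x ⟩
  x               ∎
  where instance
          y-nonZero : NonZero y
          y-nonZero = ≢-nonZero y≢0′

x*y≢0 : ∀ {x y} → x ≢ 0ℚ → y ≢ 0ℚ → x * y ≢ 0ℚ
x*y≢0 {x} {y} x≢0 y≢0 xy≡0 = x≢0 (begin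
  x            ≡⟨ sym (/'-unique y≢0 refl) ⟩
  (x * y) /' y ≡⟨ cong (_/' y) xy≡0 ⟩
  0ℚ /' y      ≡⟨ /'-unique y≢0 (*-zeroˡ y) ⟩
  0ℚ           ∎)

/'-*-/' : ∀ {x y z w} → y ≢ 0ℚ → w ≢ 0ℚ → (x /' y) * (z /' w) ≡ (x * z) /' (y * w)
/'-*-/' {x} {y} {z} {w} y≢0 w≢0 = sym (/'-unique (x*y≢0 y≢0 w≢0) (begin
  (x /' y) * (z /' w) * (y * w)    ≡⟨ interchange (x /' y) (z /' w) y w ⟩
  (x /' y * y) * (z /' w * w)      ≡⟨ cong₂ _*_ (x/'y*y≡x y≢0) (x/'y*y≡x w≢0) ⟩
  x * z                            ∎))

*-cancelʳ-/' : ∀ {x y k} → y ≢ 0ℚ → k ≢ 0ℚ → (x * k) /' (y * k) ≡ x /' y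
*-cancelʳ-/' {x} {y} {k} y≢0 k≢0 = /'-unique (x*y≢0 y≢0 k≢0) (begin
  x /' y * (y * k)  ≡⟨ sym (*-assoc (x /' y) y k) ⟩
  x /' y * y * k    ≡⟨ cong (_* k) (x/'y*y≡x y≢0) ⟩
  x * k             ∎)

0<p⇒p≢0 : ∀ {p} → 0ℚ < p → p ≢ 0ℚ
0<p⇒p≢0 0<p p≡0 = <⇒≢ 0<p (sym p≡0)

p<q⇒0<q-p : ∀ {p q} → p < q → 0ℚ < q - p
p<q⇒0<q-p {p} {q} p<q = subst (_< q - p) (+-inverseʳ p) (+-monoˡ-< (- p) p<q)

pow≤1 : ∀ {μ} → 0ℚ ≤ μ → μ ≤ 1ℚ → ∀ m → pow μ m ≤ 1ℚ
pow≤1 0≤μ μ≤1 zero        = ≤-refl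
pow≤1 {μ} 0≤μ μ≤1 (suc m) = ≤-trans (*-monoˡ-≤-nonNeg μ {{nonNegative 0≤μ}} (pow≤1 0≤μ μ≤1 m))
                                    (≤-trans (≤-reflexive (*-identityʳ μ)) μ≤1)

pow-suc<1 : ∀ {μ} → 0ℚ ≤ μ → μ < 1ℚ → ∀ m → pow μ (suc m) < 1ℚ
pow-suc<1 {μ} 0≤μ μ<1 m = ≤-<-trans (*-monoˡ-≤-nonNeg μ {{nonNegative 0≤μ}} (pow≤1 0≤μ (<⇒≤ μ<1) m))
                                    (subst (_< 1ℚ) (sym (*-identityʳ μ)) μ<1)

sumFrom1-nonNeg : ∀ {f} → (∀ m → 0ℚ ≤ f (suc m)) → ∀ L → 0ℚ ≤ sumFrom1 L f
sumFrom1-nonNeg         f≥0 zero    = ≤-refl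
sumFrom1-nonNeg {f = f} f≥0 (suc L) =
  subst (_≤ sumFrom1 (suc L) f) (+-identityʳ 0ℚ) (+-mono-≤ (sumFrom1-nonNeg f≥0 L) (f≥0 L))

sumFrom1-pos : ∀ {f} → (∀ m → 0ℚ < f (suc m)) → ∀ L → 0ℚ < sumFrom1 (suc L) f
sumFrom1-pos {f = f} f>0 L =
  subst (_< sumFrom1 (suc L) f) (+-identityʳ 0ℚ) (+-mono-≤-< (sumFrom1-nonNeg (<⇒≤ ∘ f>0) L) (f>0 L))

nu-map-not : ∀ r → nu (map not r) ≡ fromℕ (length r) - nu r
nu-map-not []          = refl
nu-map-not (false ∷ r) = begin
  1ℚ + nu (map not r)                ≡⟨ cong (1ℚ +_) (nu-map-not r) ⟩
  1ℚ + (fromℕ (length r) - nu r)     ≡⟨ +-assoc 1ℚ (fromℕ (length r)) (- nu r) ⟨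
  fromℕ (length (false ∷ r)) - nu r  ∎
nu-map-not (true ∷ r)  = begin
  nu (map not r)                           ≡⟨ nu-map-not r ⟩
  fromℕ (length r) - nu r                  ≡⟨ shift (fromℕ (length r)) (nu r) ⟩
  fromℕ (length (true ∷ r)) - (1ℚ + nu r)  ∎
  where shift : ∀ l n → l - n ≡ (1ℚ + l) - (1ℚ + n)
        shift = solve-∀ ring

module _ (μ : ℚ) where

  trans-stochastic : ∀ s → trans μ s false + trans μ s true ≡ 1ℚ
  trans-stochastic false = halves μ
    where halves : ∀ m → ½ * (1ℚ + m) + ½ * (1ℚ - m) ≡ 1ℚ
          halves = solve-∀ ring
  trans-stochastic true  = ≡-trans (+-comm (trans μ true false) (trans μ true true)) (trans-stochastic false)

  trans-not : ∀ s t → trans μ (not s) (not t) ≡ trans μ s t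
  trans-not false false = refl
  trans-not false true  = refl
  trans-not true  false = refl
  trans-not true  true  = refl

  expect-cong : ∀ s L {f g} → (∀ r → f r ≡ g r) → expect μ s L f ≡ expect μ s L g
  expect-cong s zero    f≗g = f≗g []
  expect-cong s (suc L) f≗g =
    cong₂ _+_ (cong (trans μ s false *_) (expect-cong false L (f≗g ∘ (false ∷_))))
              (cong (trans μ s true  *_) (expect-cong true  L (f≗g ∘ (true  ∷_))))

  expect-const : ∀ s L k → expect μ s L (λ _ → k) ≡ k
  expect-const s zero    k = refl
  expect-const s (suc L) k = begin
    p * expect μ false L (λ _ → k) + q * expect μ true L (λ _ → k)
      ≡⟨ cong₂ (λ a b → p * a + q * b) (expect-const false L k) (expect-const true L k) ⟩
    p * k + q * k      ≡⟨ *-distribʳ-+ k p q ⟨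
    (p + q) * k        ≡⟨ cong (_* k) (trans-stochastic s) ⟩
    1ℚ * k             ≡⟨ *-identityˡ k ⟩
    k                  ∎
    where
      p q : ℚ
      p = trans μ s false
      q = trans μ s true

  expect-+ : ∀ s L f g → expect μ s L (λ r → f r + g r) ≡ expect μ s L f + expect μ s L g
  expect-+ s zero    f g = refl
  expect-+ s (suc L) f g = begin
    p * expect μ false L (λ r → f (false ∷ r) + g (false ∷ r)) + q * expect μ true L (λ r → f (true ∷ r) + g (true ∷ r))
      ≡⟨ cong₂ (λ a b → p * a + q * b) (expect-+ false L _ _) (expect-+ true L _ _) ⟩
    p * (f₀ + g₀) + q * (f₁ + g₁)
      ≡⟨ distrib p q f₀ g₀ f₁ g₁ ⟩
    (p * f₀ + q * f₁) + (p * g₀ + q * g₁) ∎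
    where
      p q f₀ g₀ f₁ g₁ : ℚ
      p = trans μ s false
      q = trans μ s true
      f₀ = expect μ false L (f ∘ (false ∷_))
      g₀ = expect μ false L (g ∘ (false ∷_))
      f₁ = expect μ true L (f ∘ (true ∷_))
      g₁ = expect μ true L (g ∘ (true ∷_))
      distrib : ∀ p q a b c d → p * (a + b) + q * (c + d) ≡ (p * a + q * c) + (p * b + q * d)
      distrib = solve-∀ ring

  expect-*ˡ : ∀ s L k f → expect μ s L (λ r → k * f r) ≡ k * expect μ s L f
  expect-*ˡ s zero    k f = refl
  expect-*ˡ s (suc L) k f = begin
    p * expect μ false L (λ r → k * f (false ∷ r)) + q * expect μ true L (λ r → k * f (true ∷ r))
      ≡⟨ cong₂ (λ a b → p * a + q * b) (expect-*ˡ false L k _) (expect-*ˡ true L k _) ⟩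
    p * (k * f₀) + q * (k * f₁)
      ≡⟨ distrib p q k f₀ f₁ ⟩
    k * (p * f₀ + q * f₁) ∎
    where
      p q f₀ f₁ : ℚ
      p = trans μ s false
      q = trans μ s true
      f₀ = expect μ false L (f ∘ (false ∷_))
      f₁ = expect μ true L (f ∘ (true ∷_))
      distrib : ∀ p q k a b → p * (k * a) + q * (k * b) ≡ k * (p * a + q * b)
      distrib = solve-∀ ring

  expect-affine : ∀ s L x y f → expect μ s L (λ r → x + y * f r) ≡ x + y * expect μ s L f
  expect-affine s L x y f = begin
    expect μ s L (λ r → x + y * f r)                       ≡⟨ expect-+ s L (λ _ → x) (λ r → y * f r) ⟩
    expect μ s L (λ _ → x) + expect μ s L (λ r → y * f r)  ≡⟨ cong₂ _+_ (expect-const s L x) (expect-*ˡ s L y f) ⟩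
    x + y * expect μ s L f                                 ∎

  expect-length : ∀ s L (f : ℕ → List Bool → ℚ) → expect μ s L (λ r → f (length r) r) ≡ expect μ s L (f L)
  expect-length s zero    f = refl
  expect-length s (suc L) f =
    cong₂ _+_ (cong (trans μ s false *_) (expect-length false L (λ n r → f (suc n) (false ∷ r))))
              (cong (trans μ s true  *_) (expect-length true  L (λ n r → f (suc n) (true  ∷ r))))

  expect-not : ∀ s L f → expect μ s L f ≡ expect μ (not s) L (f ∘ map not)
  expect-not s zero    f = refl
  expect-not s (suc L) f = begin
    p * expect μ false L (f ∘ (false ∷_)) + q * expect μ true L (f ∘ (true ∷_))
      ≡⟨ cong₂ (λ x y → p * x + q * y) (expect-not false L _) (expect-not true L _) ⟩
    p * a + q * b                                      ≡⟨ +-comm (p * a) (q * b) ⟩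
    q * b + p * a                                      ≡⟨ cong₂ (λ p′ q′ → q′ * b + p′ * a) (trans-not s false) (trans-not s true) ⟨
    trans μ (not s) false * b + trans μ (not s) true * a ∎
    where
      p q a b : ℚ
      p = trans μ s false
      q = trans μ s true
      a = expect μ true  L (λ r → f (false ∷ map not r))
      b = expect μ false L (λ r → f (true  ∷ map not r))

  expect-true-nu : ∀ L (φ : ℚ → ℚ) → expect μ true L (φ ∘ nu) ≡ expect μ false L (λ r → φ (fromℕ L - nu r))
  expect-true-nu L φ = begin
    expect μ true L (φ ∘ nu)                                  ≡⟨ expect-not true L (φ ∘ nu) ⟩
    expect μ false L (φ ∘ nu ∘ map not)                       ≡⟨ expect-cong false L (cong φ ∘ nu-map-not) ⟩
    expect μ false L (λ r → φ (fromℕ (length r) - nu r))     ≡⟨ expect-length false L (λ n r → φ (fromℕ n - nu r)) ⟩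
    expect μ false L (λ r → φ (fromℕ L - nu r))              ∎

  nu-first-step : ∀ L (φ : ℚ → ℚ) →
    expect μ false (suc L) (φ ∘ nu) ≡
      ½ * (1ℚ + μ) * expect μ false L (φ ∘ nu) + ½ * (1ℚ - μ) * expect μ false L (λ r → φ (fromℕ (suc L) - nu r))
  nu-first-step L φ = cong (½ * (1ℚ + μ) * expect μ false L (φ ∘ nu) +_) (cong (½ * (1ℚ - μ) *_) (begin
    expect μ true L (λ r → φ (1ℚ + nu r))                     ≡⟨ expect-true-nu L (λ x → φ (1ℚ + x)) ⟩
    expect μ false L (λ r → φ (1ℚ + (fromℕ L - nu r)))        ≡⟨ expect-cong false L (λ r → cong φ (+-assoc 1ℚ (fromℕ L) (- nu r))) ⟨
    expect μ false L (λ r → φ (fromℕ (suc L) - nu r))        ∎))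

  secondMomentNu : ℕ → ℚ
  secondMomentNu L = expect μ false L (λ r → nu r * nu r)

  -- E[(1 − 2σ₀) + … + (1 − 2σ_L)], which is 1 + μ + … + μ^L.
  spinSum : ℕ → ℚ
  spinSum L = fromℕ (suc L) - two * meanNu μ L

  meanNu-suc : ∀ L → meanNu μ (suc L) ≡ μ * meanNu μ L + ½ * (1ℚ - μ) * fromℕ (suc L)
  meanNu-suc L = begin
    meanNu μ (suc L)
      ≡⟨ nu-first-step L (λ x → x) ⟩
    ½ * (1ℚ + μ) * a + ½ * (1ℚ - μ) * expect μ false L (λ r → l - nu r)
      ≡⟨ cong (λ e → ½ * (1ℚ + μ) * a + ½ * (1ℚ - μ) * e) reflected ⟩
    ½ * (1ℚ + μ) * a + ½ * (1ℚ - μ) * (l + - 1ℚ * a)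
      ≡⟨ collect μ a l ⟩
    μ * a + ½ * (1ℚ - μ) * l
      ∎
    where
      a l : ℚ
      a = meanNu μ L
      l = fromℕ (suc L)
      reflected : expect μ false L (λ r → l - nu r) ≡ l + - 1ℚ * a
      reflected = begin
        expect μ false L (λ r → l - nu r)          ≡⟨ expect-cong false L (λ r → cong (l +_) (-1*x≡-x (nu r))) ⟨
        expect μ false L (λ r → l + - 1ℚ * nu r)   ≡⟨ expect-affine false L l (- 1ℚ) nu ⟩
        l + - 1ℚ * a                               ∎
        where -1*x≡-x : ∀ x → - 1ℚ * x ≡ - x
              -1*x≡-x = solve-∀ ring
      collect : ∀ m a l → ½ * (1ℚ + m) * a + ½ * (1ℚ - m) * (l + - 1ℚ * a) ≡ m * a + ½ * (1ℚ - m) * l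
      collect = solve-∀ ring

  secondMomentNu-suc : ∀ L →
    secondMomentNu (suc L) ≡ secondMomentNu L + ½ * (1ℚ - μ) * fromℕ (suc L) * spinSum L
  secondMomentNu-suc L = begin
    secondMomentNu (suc L)
      ≡⟨ nu-first-step L (λ x → x * x) ⟩
    ½ * (1ℚ + μ) * b + ½ * (1ℚ - μ) * expect μ false L (λ r → (l - nu r) * (l - nu r))
      ≡⟨ cong (λ e → ½ * (1ℚ + μ) * b + ½ * (1ℚ - μ) * e) reflected ⟩
    ½ * (1ℚ + μ) * b + ½ * (1ℚ - μ) * ((l * l + - (two * l) * a) + b)
      ≡⟨ collect μ a b l ⟩
    b + ½ * (1ℚ - μ) * l * spinSum L
      ∎
    where
      a b l : ℚ
      a = meanNu μ L
      b = secondMomentNu L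
      l = fromℕ (suc L)
      expand : ∀ l n → (l - n) * (l - n) ≡ (l * l + - (two * l) * n) + n * n
      expand = solve-∀ ring
      reflected : expect μ false L (λ r → (l - nu r) * (l - nu r)) ≡ (l * l + - (two * l) * a) + b
      reflected = begin
        expect μ false L (λ r → (l - nu r) * (l - nu r))
          ≡⟨ expect-cong false L (λ r → expand l (nu r)) ⟩
        expect μ false L (λ r → (l * l + - (two * l) * nu r) + nu r * nu r)
          ≡⟨ expect-+ false L (λ r → l * l + - (two * l) * nu r) (λ r → nu r * nu r) ⟩
        expect μ false L (λ r → l * l + - (two * l) * nu r) + b
          ≡⟨ cong (_+ b) (expect-affine false L (l * l) (- (two * l)) nu) ⟩
        (l * l + - (two * l) * a) + b             ∎
      collect : ∀ m a b l → ½ * (1ℚ + m) * b + ½ * (1ℚ - m) * ((l * l + - (two * l) * a) + b)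
                          ≡ b + ½ * (1ℚ - m) * l * (l - two * a)
      collect = solve-∀ ring

  varNu-suc : ∀ L → varNu μ (suc L) ≡ varNu μ L + ½ * ½ * (1ℚ - μ * μ) * (spinSum L * spinSum L)
  varNu-suc L = begin
    varNu μ (suc L)
      ≡⟨ cong₂ (λ b a → b - a * a) (secondMomentNu-suc L) (meanNu-suc L) ⟩
    (secondMomentNu L + ½ * (1ℚ - μ) * l * spinSum L) - (μ * a + ½ * (1ℚ - μ) * l) * (μ * a + ½ * (1ℚ - μ) * l)
      ≡⟨ complete-square μ (secondMomentNu L) a l ⟩
    varNu μ L + ½ * ½ * (1ℚ - μ * μ) * (spinSum L * spinSum L)
      ∎
    where
      a l : ℚ
      a = meanNu μ L
      l = fromℕ (suc L)
      complete-square : ∀ m b a l →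
        (b + ½ * (1ℚ - m) * l * (l - two * a)) - (m * a + ½ * (1ℚ - m) * l) * (m * a + ½ * (1ℚ - m) * l)
          ≡ (b - a * a) + ½ * ½ * (1ℚ - m * m) * ((l - two * a) * (l - two * a))
      complete-square = solve-∀ ring

  spinSum-geometric : ∀ L → (1ℚ - μ) * spinSum L ≡ 1ℚ - pow μ (suc L)
  spinSum-geometric zero    = base μ
    where base : ∀ m → (1ℚ - m) * ((1ℚ + 0ℚ) - two * 0ℚ) ≡ 1ℚ - m * 1ℚ
          base = solve-∀ ring
  spinSum-geometric (suc L) = begin
    (1ℚ - μ) * ((1ℚ + l) - two * meanNu μ (suc L))
      ≡⟨ cong (λ a → (1ℚ - μ) * ((1ℚ + l) - two * a)) (meanNu-suc L) ⟩
    (1ℚ - μ) * ((1ℚ + l) - two * (μ * a + ½ * (1ℚ - μ) * l))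
      ≡⟨ rearrange μ a l ⟩
    (1ℚ - μ) + μ * ((1ℚ - μ) * spinSum L)
      ≡⟨ cong (λ x → (1ℚ - μ) + μ * x) (spinSum-geometric L) ⟩
    (1ℚ - μ) + μ * (1ℚ - pow μ (suc L))
      ≡⟨ telescope μ (pow μ (suc L)) ⟩
    1ℚ - μ * pow μ (suc L) ∎
    where
      a l : ℚ
      a = meanNu μ L
      l = fromℕ (suc L)
      rearrange : ∀ m a l → (1ℚ - m) * ((1ℚ + l) - two * (m * a + ½ * (1ℚ - m) * l))
                            ≡ (1ℚ - m) + m * ((1ℚ - m) * (l - two * a))
      rearrange = solve-∀ ring
      telescope : ∀ m q → (1ℚ - m) + m * (1ℚ - q) ≡ 1ℚ - m * q
      telescope = solve-∀ ring

  S₁ : ℕ → ℚ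
  S₁ L = sumFrom1 L (λ m → 1ℚ - pow μ m)

  S₂ : ℕ → ℚ
  S₂ L = sumFrom1 L (λ m → (1ℚ - pow μ m) * (1ℚ - pow μ m))

  meanNu-closed : ∀ L → two * meanNu μ L ≡ S₁ L
  meanNu-closed zero    = *-zeroʳ two
  meanNu-closed (suc L) = begin
    two * meanNu μ (suc L)                       ≡⟨ cong (two *_) (meanNu-suc L) ⟩
    two * (μ * a + ½ * (1ℚ - μ) * l)             ≡⟨ rearrange μ a l ⟩
    two * a + (1ℚ - μ) * spinSum L               ≡⟨ cong₂ _+_ (meanNu-closed L) (spinSum-geometric L) ⟩
    S₁ L + (1ℚ - pow μ (suc L))                  ∎
    where
      a l : ℚ
      a = meanNu μ L
      l = fromℕ (suc L)
      rearrange : ∀ m a l → two * (m * a + ½ * (1ℚ - m) * l) ≡ two * a + (1ℚ - m) * (l - two * a)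
      rearrange = solve-∀ ring

  varNu-closed : ∀ L → two * two * (1ℚ - μ) * varNu μ L ≡ (1ℚ + μ) * S₂ L
  varNu-closed zero    = base μ
    where base : ∀ m → two * two * (1ℚ - m) * (0ℚ * 0ℚ - 0ℚ * 0ℚ) ≡ (1ℚ + m) * 0ℚ
          base = solve-∀ ring
  varNu-closed (suc L) = begin
    k * varNu μ (suc L)
      ≡⟨ cong (k *_) (varNu-suc L) ⟩
    k * (varNu μ L + ½ * ½ * (1ℚ - μ * μ) * (spinSum L * spinSum L))
      ≡⟨ rearrange μ (varNu μ L) (spinSum L) ⟩
    k * varNu μ L + (1ℚ + μ) * (((1ℚ - μ) * spinSum L) * ((1ℚ - μ) * spinSum L))
      ≡⟨ cong₂ (λ x y → x + (1ℚ + μ) * (y * y)) (varNu-closed L) (spinSum-geometric L) ⟩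
    (1ℚ + μ) * S₂ L + (1ℚ + μ) * ((1ℚ - q) * (1ℚ - q))
      ≡⟨ *-distribˡ-+ (1ℚ + μ) (S₂ L) _ ⟨
    (1ℚ + μ) * S₂ (suc L)
      ∎
    where
      k q : ℚ
      k = two * two * (1ℚ - μ)
      q = pow μ (suc L)
      rearrange : ∀ m v g → two * two * (1ℚ - m) * (v + ½ * ½ * (1ℚ - m * m) * (g * g))
                            ≡ two * two * (1ℚ - m) * v + (1ℚ + m) * (((1ℚ - m) * g) * ((1ℚ - m) * g))
      rearrange = solve-∀ ring

corollary7p7 : (μ : ℚ) → 0ℚ < μ → μ < 1ℚ → (L : ℕ) → L ≥ 1 →
    D L μ ≡ Dinf μ * (sumFrom1 L (λ m → (1ℚ - pow μ m) * (1ℚ - pow μ m))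
                      /' sumFrom1 L (λ m → 1ℚ - pow μ m))
corollary7p7 μ 0<μ μ<1 L@(suc L-1) _ = begin
  v /' a
    ≡⟨ *-cancelʳ-/' a≢0 k≢0 ⟨
  (v * k) /' (a * k)
    ≡⟨ cong₂ _/'_ (*-comm v k) (regroup μ a) ⟩
  (k * v) /' (two * (1ℚ - μ) * (two * a))
    ≡⟨ cong₂ (λ x y → x /' (two * (1ℚ - μ) * y)) (varNu-closed μ L) (meanNu-closed μ L) ⟩
  ((1ℚ + μ) * S₂ μ L) /' (two * (1ℚ - μ) * S₁ μ L)
    ≡⟨ /'-*-/' 2[1-μ]≢0 S₁≢0 ⟨
  ((1ℚ + μ) /' (two * (1ℚ - μ))) * (S₂ μ L /' S₁ μ L)
    ∎
  where
    v a k : ℚ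
    v = varNu μ L
    a = meanNu μ L
    k = two * two * (1ℚ - μ)
    1-μ≢0 : 1ℚ - μ ≢ 0ℚ
    1-μ≢0 = 0<p⇒p≢0 (p<q⇒0<q-p μ<1)
    2≢0 : two ≢ 0ℚ
    2≢0 ()
    2[1-μ]≢0 : two * (1ℚ - μ) ≢ 0ℚ
    2[1-μ]≢0 = x*y≢0 2≢0 1-μ≢0
    k≢0 : k ≢ 0ℚ
    k≢0 = x*y≢0 (x*y≢0 2≢0 2≢0) 1-μ≢0
    S₁≢0 : S₁ μ L ≢ 0ℚ
    S₁≢0 = 0<p⇒p≢0 (sumFrom1-pos (λ m → p<q⇒0<q-p (pow-suc<1 (<⇒≤ 0<μ) μ<1 m)) L-1)
    a≢0 : a ≢ 0ℚ
    a≢0 a≡0 = S₁≢0 (≡-trans (sym (meanNu-closed μ L)) (≡-trans (cong (two *_) a≡0) (*-zeroʳ two)))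
    regroup : ∀ m a → a * (two * two * (1ℚ - m)) ≡ two * (1ℚ - m) * (two * a)
    regroup = solve-∀ ring
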